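{- Let $m\ge2$ be an integer. There is no integer $N\ge1$ such that $\beta^+(N)$ has suffix $10^{2m}1$, i.e. no $N$ with $d_{2m+1}(N)d_{2m}(N)\cdots d_0(N)=10^{2m}1$.
   Context: Let $\varphi=(1+\sqrt5)/2$. Every integer $N\ge1$ has a unique base phi expansion $N=\sum_{i\in\mathbb Z} d_i(N)\varphi^i$ with $d_i(N)\in\{0,1\}$, finitely many nonzero, and $d_i(N)d_{i+1}(N)=0$ for all $i$. With $L$ the largest index such that $d_L(N)=1$, $\beta^+(N)=d_L(N)\cdots d_0(N)$. $0^k$ denotes the word of $k$ zeros. -}

module Defs where

open import Data.Bool using (Bool; true; false; if_then_else_)
open import Data.List using (List; []; _∷_)
open import Data.Nat as ℕ using (ℕ; zero; suc)
open import Data.Integer as ℤ using (ℤ; +_; -[1+_]; _-_)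
open import Data.Product using (_×_; _,_)
open import Data.Unit using (⊤)
open import Data.Empty using (⊥)
open import Relation.Binary.PropositionalEquality using (_≡_)

-- Elements of ℤ[φ]: the pair (a , b) stands for a + b·φ.
-- Since φ is irrational, a + bφ = c + dφ (as reals) iff a = c and b = d,
-- so propositional equality of pairs is equality of real numbers.
Zφ : Set
Zφ = ℤ × ℤ

0φ : Zφ
0φ = + 0 , + 0

_+φ_ : Zφ → Zφ → Zφ
(a , b) +φ (c , d) = (a ℤ.+ c) , (b ℤ.+ d)

-- uses φ² = φ + 1
_*φ_ : Zφ → Zφ → Zφ
(a , b) *φ (c , d) = (a ℤ.* c ℤ.+ b ℤ.* d) , (a ℤ.* d ℤ.+ b ℤ.* c ℤ.+ b ℤ.* d)

φ : Zφ
φ = + 0 , + 1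

-- φ⁻¹ = φ - 1
φ⁻¹ : Zφ
φ⁻¹ = ℤ.-[1+ 0 ] , + 1

powℕ : Zφ → ℕ → Zφ
powℕ x zero = + 1 , + 0
powℕ x (suc n) = x *φ powℕ x n

φ^ : ℤ → Zφ
φ^ (+ n) = powℕ φ n
φ^ -[1+ n ] = powℕ φ⁻¹ (suc n)

-- A finite base-phi digit string: digits d_low, d_{low+1}, …, d_{low+len-1}
-- given by the list `bits` (head = lowest index); all other digits are 0.
record Expansion : Set where
  constructor mkExp
  field
    low  : ℤ
    bits : List Bool
open Expansion public

lookupB : List Bool → ℕ → Bool
lookupB [] _ = false
lookupB (b ∷ bs) zero = b
lookupB (b ∷ bs) (suc n) = lookupB bs n

dig : Expansion → ℤ → Bool
dig E i with i - low E
... | + n = lookupB (bits E) n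
... | -[1+ _ ] = false

NoAdj : List Bool → Set
NoAdj [] = ⊤
NoAdj (_ ∷ []) = ⊤
NoAdj (true ∷ true ∷ _) = ⊥
NoAdj (true ∷ false ∷ xs) = NoAdj (false ∷ xs)
NoAdj (false ∷ y ∷ xs) = NoAdj (y ∷ xs)

valAux : ℤ → List Bool → Zφ
valAux k [] = 0φ
valAux k (b ∷ bs) = (if b then φ^ k else 0φ) +φ valAux (k ℤ.+ + 1) bs

value : Expansion → Zφ
value E = valAux (low E) (bits E)

IsBasePhiExpansion : ℕ → Expansion → Set
IsBasePhiExpansion N E = NoAdj (bits E) × value E ≡ (+ N , + 0)

module Submission where

-- Write N = F + 1 + φ^ℓ + A with ℓ = 2m + 1, where F collects the digits below position 0 and A
-- those above ℓ. The Galois conjugation φ ↦ −φ⁻¹ fixes N and sends φ^ℓ to −φ^(−ℓ), so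
-- F + φ^(−ℓ) = k + Ā for an integer k, Ā being the conjugate of A. Non-adjacency of the digits
-- gives 0 ≤ F < φ^(−1) and |Ā| ≤ φ^(−ℓ−1), whence
--   0 < φ^(−ℓ) − φ^(−ℓ−1) ≤ k ≤ F + φ^(−ℓ) + φ^(−ℓ−1) = F + φ^(−2m) < φ^(−1) + φ^(−2) = 1.
-- Without real numbers, x ≤ y is certified by writing y − x as a finite sum of powers φ^(−t);
-- multiplying by a large power of φ shows that a nonempty such sum is never 0.

open import Defs
open import Algebra.Bundles using (AbelianGroup)
open import Algebra.Structures using (IsAbelianGroup)
open import Data.Bool using (Bool; true; false; if_then_else_)
open import Data.Empty using (⊥; ⊥-elim)
open import Data.Integer as ℤ using (ℤ; +_; -[1+_])
import Data.Integer.Properties as ℤP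
open import Data.Integer.Tactic.RingSolver using (solve)
open import Data.List using (List; []; _∷_; _++_; length; replicate)
open import Data.Nat using (ℕ; zero; suc; z≤n; s≤s; _≤_; _<_; _+_; _*_; _∸_)
open import Data.Nat.ListAction using (sum)
import Data.Nat.Properties as ℕP
open import Data.Product using (∃-syntax; _×_; _,_; proj₁; proj₂)
open import Data.Sum using (_⊎_; inj₁; inj₂)
open import Data.Unit using (tt)
open import Function using (_∘_)
open import Level using (0ℓ)
open import Relation.Binary.Structures using (IsPreorder)
open import Relation.Binary.PropositionalEquality
open import Relation.Nullary using (¬_; yes; no)
import Relation.Binary.Reasoning.Base.Triple as TripleReasoning

ι : ℤ → Zφ
ι k = k , + 0

negφ : Zφ → Zφ
negφ (a , b) = ℤ.- a , ℤ.- b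

-- a + bφ ↦ a + b(1 − φ)
conj : Zφ → Zφ
conj (a , b) = a ℤ.+ b , ℤ.- b

mulφ : Zφ → Zφ
mulφ (a , b) = b , a ℤ.+ b

mulφ⁻¹ : Zφ → Zφ
mulφ⁻¹ (a , b) = b ℤ.- a , a

φ⁺ : ℕ → Zφ
φ⁺ zero = ι (+ 1)
φ⁺ (suc t) = mulφ (φ⁺ t)

φ⁻ : ℕ → Zφ
φ⁻ zero = ι (+ 1)
φ⁻ (suc t) = mulφ⁻¹ (φ⁻ t)

φ*≡mulφ : ∀ x → φ *φ x ≡ mulφ x
φ*≡mulφ (a , b) = cong₂ _,_ (solve (a ∷ b ∷ [])) (solve (a ∷ b ∷ []))

φ⁻¹*≡mulφ⁻¹ : ∀ x → φ⁻¹ *φ x ≡ mulφ⁻¹ x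
φ⁻¹*≡mulφ⁻¹ (a , b) = cong₂ _,_ (solve (a ∷ b ∷ [])) (solve (a ∷ b ∷ []))

powℕ-φ : ∀ t → powℕ φ t ≡ φ⁺ t
powℕ-φ zero = refl
powℕ-φ (suc t) = trans (φ*≡mulφ (powℕ φ t)) (cong mulφ (powℕ-φ t))

powℕ-φ⁻¹ : ∀ t → powℕ φ⁻¹ t ≡ φ⁻ t
powℕ-φ⁻¹ zero = refl
powℕ-φ⁻¹ (suc t) = trans (φ⁻¹*≡mulφ⁻¹ (powℕ φ⁻¹ t)) (cong mulφ⁻¹ (powℕ-φ⁻¹ t))

mulφ∘mulφ⁻¹ : ∀ x → mulφ (mulφ⁻¹ x) ≡ x
mulφ∘mulφ⁻¹ (a , b) = eq
  where
  eq : mulφ (b ℤ.- a , a) ≡ (a , b)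
  eq = cong₂ _,_ (solve (a ∷ b ∷ [])) (solve (a ∷ b ∷ []))

mulφ⁻¹-split : ∀ x → x ≡ mulφ⁻¹ x +φ mulφ⁻¹ (mulφ⁻¹ x)
mulφ⁻¹-split (a , b) = eq
  where
  eq : (a , b) ≡ (b ℤ.- a , a) +φ (a ℤ.- (b ℤ.- a) , b ℤ.- a)
  eq = cong₂ _,_ (solve (a ∷ b ∷ [])) (solve (a ∷ b ∷ []))

conj-+φ : ∀ x y → conj (x +φ y) ≡ conj x +φ conj y
conj-+φ (a , b) (c , d) = eq
  where
  eq : ((a ℤ.+ c) ℤ.+ (b ℤ.+ d) , ℤ.- (b ℤ.+ d)) ≡ ((a ℤ.+ b) ℤ.+ (c ℤ.+ d) , ℤ.- b ℤ.+ ℤ.- d)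
  eq = cong₂ _,_ (solve (a ∷ b ∷ c ∷ d ∷ [])) (solve (b ∷ d ∷ []))

conj-mulφ : ∀ x → conj (mulφ x) ≡ negφ (mulφ⁻¹ (conj x))
conj-mulφ (a , b) = eq
  where
  eq : (b ℤ.+ (a ℤ.+ b) , ℤ.- (a ℤ.+ b)) ≡ negφ (ℤ.- b ℤ.- (a ℤ.+ b) , a ℤ.+ b)
  eq = cong₂ _,_ (solve (a ∷ b ∷ [])) (solve (a ∷ b ∷ []))

negφ∘mulφ⁻¹∘negφ : ∀ x → negφ (mulφ⁻¹ (negφ x)) ≡ mulφ⁻¹ x
negφ∘mulφ⁻¹∘negφ (a , b) = eq
  where
  eq : negφ (ℤ.- b ℤ.- ℤ.- a , ℤ.- a) ≡ (b ℤ.- a , a)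
  eq = cong₂ _,_ (solve (a ∷ b ∷ [])) (solve (a ∷ b ∷ []))

+φ-assoc : ∀ x y z → (x +φ y) +φ z ≡ x +φ (y +φ z)
+φ-assoc (a , b) (c , d) (e , f) = cong₂ _,_ (ℤP.+-assoc a c e) (ℤP.+-assoc b d f)

+φ-comm : ∀ x y → x +φ y ≡ y +φ x
+φ-comm (a , b) (c , d) = cong₂ _,_ (ℤP.+-comm a c) (ℤP.+-comm b d)

+φ-identityˡ : ∀ x → 0φ +φ x ≡ x
+φ-identityˡ (a , b) = cong₂ _,_ (ℤP.+-identityˡ a) (ℤP.+-identityˡ b)

+φ-identityʳ : ∀ x → x +φ 0φ ≡ x
+φ-identityʳ (a , b) = cong₂ _,_ (ℤP.+-identityʳ a) (ℤP.+-identityʳ b)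

+φ-inverseˡ : ∀ x → negφ x +φ x ≡ 0φ
+φ-inverseˡ (a , b) = cong₂ _,_ (ℤP.+-inverseˡ a) (ℤP.+-inverseˡ b)

+φ-inverseʳ : ∀ x → x +φ negφ x ≡ 0φ
+φ-inverseʳ (a , b) = cong₂ _,_ (ℤP.+-inverseʳ a) (ℤP.+-inverseʳ b)

+φ-isAbelianGroup : IsAbelianGroup _≡_ _+φ_ 0φ negφ
+φ-isAbelianGroup = record
  { isGroup = record
    { isMonoid = record
      { isSemigroup = record
        { isMagma = record { isEquivalence = isEquivalence ; ∙-cong = cong₂ _+φ_ }
        ; assoc = +φ-assoc
        }
      ; identity = +φ-identityˡ , +φ-identityʳ
      }
    ; inverse = +φ-inverseˡ , +φ-inverseʳ
    ; ⁻¹-cong = cong negφ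
    }
  ; comm = +φ-comm
  }

+φ-abelianGroup : AbelianGroup 0ℓ 0ℓ
+φ-abelianGroup = record { isAbelianGroup = +φ-isAbelianGroup }

open import Algebra.Properties.Group (AbelianGroup.group +φ-abelianGroup)
  using (∙-cancelˡ)
open import Algebra.Properties.CommutativeSemigroup (AbelianGroup.commutativeSemigroup +φ-abelianGroup)
  using (interchange; xy∙z≈xz∙y; xy∙z≈y∙xz)

conj-φ⁺-suc⁺ : ∀ t → conj (φ⁺ t) ≡ φ⁻ t → conj (φ⁺ (suc t)) ≡ negφ (φ⁻ (suc t))
conj-φ⁺-suc⁺ t eq = trans (conj-mulφ (φ⁺ t)) (cong (negφ ∘ mulφ⁻¹) eq)

conj-φ⁺-suc⁻ : ∀ t → conj (φ⁺ t) ≡ negφ (φ⁻ t) → conj (φ⁺ (suc t)) ≡ φ⁻ (suc t)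
conj-φ⁺-suc⁻ t eq =
  trans (conj-mulφ (φ⁺ t)) (trans (cong (negφ ∘ mulφ⁻¹) eq) (negφ∘mulφ⁻¹∘negφ (φ⁻ t)))

conj-φ⁺ : ∀ t → conj (φ⁺ t) ≡ φ⁻ t ⊎ conj (φ⁺ t) ≡ negφ (φ⁻ t)
conj-φ⁺ zero = inj₁ refl
conj-φ⁺ (suc t) with conj-φ⁺ t
... | inj₁ eq = inj₂ (conj-φ⁺-suc⁺ t eq)
... | inj₂ eq = inj₁ (conj-φ⁺-suc⁻ t eq)

conj-φ⁺-even : ∀ m → conj (φ⁺ (2 * m)) ≡ φ⁻ (2 * m)
conj-φ⁺-odd : ∀ m → conj (φ⁺ (suc (2 * m))) ≡ negφ (φ⁻ (suc (2 * m)))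
conj-φ⁺-even zero = refl
conj-φ⁺-even (suc m) = subst (λ s → conj (φ⁺ s) ≡ φ⁻ s) (sym (ℕP.*-suc 2 m))
  (conj-φ⁺-suc⁻ (suc (2 * m)) (conj-φ⁺-odd m))
conj-φ⁺-odd m = conj-φ⁺-suc⁺ (2 * m) (conj-φ⁺-even m)

Σφ⁻ : List ℕ → Zφ
Σφ⁻ [] = 0φ
Σφ⁻ (t ∷ ts) = φ⁻ t +φ Σφ⁻ ts

Σφ⁻-++ : ∀ ts us → Σφ⁻ (ts ++ us) ≡ Σφ⁻ ts +φ Σφ⁻ us
Σφ⁻-++ [] us = sym (+φ-identityˡ (Σφ⁻ us))
Σφ⁻-++ (t ∷ ts) us = trans (cong (φ⁻ t +φ_) (Σφ⁻-++ ts us)) (sym (+φ-assoc (φ⁻ t) (Σφ⁻ ts) (Σφ⁻ us)))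

Σφ⁻-replicate-0 : ∀ n → Σφ⁻ (replicate n 0) ≡ ι (+ n)
Σφ⁻-replicate-0 zero = refl
Σφ⁻-replicate-0 (suc n) = cong (ι (+ 1) +φ_) (Σφ⁻-replicate-0 n)

mulφ^ : ℕ → Zφ → Zφ
mulφ^ zero x = x
mulφ^ (suc n) x = mulφ^ n (mulφ x)

mulφ^-+φ : ∀ n x y → mulφ^ n (x +φ y) ≡ mulφ^ n x +φ mulφ^ n y
mulφ^-+φ zero x y = refl
mulφ^-+φ (suc n) (a , b) (c , d) = trans (cong (mulφ^ n) eq) (mulφ^-+φ n (b , a ℤ.+ b) (d , c ℤ.+ d))
  where
  eq : (b ℤ.+ d , (a ℤ.+ c) ℤ.+ (b ℤ.+ d)) ≡ (b ℤ.+ d , (a ℤ.+ b) ℤ.+ (c ℤ.+ d))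
  eq = cong (b ℤ.+ d ,_) (solve (a ∷ b ∷ c ∷ d ∷ []))

mulφ^-0φ : ∀ n → mulφ^ n 0φ ≡ 0φ
mulφ^-0φ zero = refl
mulφ^-0φ (suc n) = mulφ^-0φ n

mulφ^-φ⁻ : ∀ t d → mulφ^ (t + d) (φ⁻ t) ≡ mulφ^ d (ι (+ 1))
mulφ^-φ⁻ zero d = refl
mulφ^-φ⁻ (suc t) d = trans (cong (mulφ^ (t + d)) (mulφ∘mulφ⁻¹ (φ⁻ t))) (mulφ^-φ⁻ t d)

NaturalCoords : Zφ → Set
NaturalCoords x = ∃[ u ] ∃[ v ] x ≡ (+ u , + v)

NonzeroNaturalCoords : Zφ → Set
NonzeroNaturalCoords x = ∃[ u ] ∃[ v ] x ≡ (+ u , + v) × 1 ≤ u + v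

nonzero⇒natural : ∀ {x} → NonzeroNaturalCoords x → NaturalCoords x
nonzero⇒natural (u , v , eq , _) = u , v , eq

natural-+φ : ∀ {x y} → NaturalCoords x → NaturalCoords y → NaturalCoords (x +φ y)
natural-+φ (u , v , refl) (u′ , v′ , refl) = u + u′ , v + v′ , refl

nonzero-+φ : ∀ {x y} → NonzeroNaturalCoords x → NaturalCoords y → NonzeroNaturalCoords (x +φ y)
nonzero-+φ (u , v , refl , 1≤u+v) (u′ , v′ , refl) =
  u + u′ , v + v′ , refl , ℕP.≤-trans 1≤u+v (ℕP.+-mono-≤ (ℕP.m≤m+n u u′) (ℕP.m≤m+n v v′))

¬nonzero-0φ : ¬ NonzeroNaturalCoords 0φ
¬nonzero-0φ (.0 , .0 , refl , ())

mulφ^-nonzero : ∀ n {x} → NonzeroNaturalCoords x → NonzeroNaturalCoords (mulφ^ n x)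
mulφ^-nonzero zero nz = nz
mulφ^-nonzero (suc n) (u , v , refl , 1≤u+v) =
  mulφ^-nonzero n (v , u + v , refl , ℕP.≤-trans 1≤u+v (ℕP.m≤n+m (u + v) v))

mulφ^-φ⁻-nonzero : ∀ {t n} → t ≤ n → NonzeroNaturalCoords (mulφ^ n (φ⁻ t))
mulφ^-φ⁻-nonzero {t} {n} t≤n = subst (λ s → NonzeroNaturalCoords (mulφ^ s (φ⁻ t))) (ℕP.m+[n∸m]≡n t≤n)
  (subst NonzeroNaturalCoords (sym (mulφ^-φ⁻ t (n ∸ t))) (mulφ^-nonzero (n ∸ t) (1 , 0 , refl , ℕP.≤-refl)))

mulφ^-Σφ⁻-natural : ∀ {n} ts → sum ts ≤ n → NaturalCoords (mulφ^ n (Σφ⁻ ts))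
mulφ^-Σφ⁻-natural {n} [] _ = 0 , 0 , mulφ^-0φ n
mulφ^-Σφ⁻-natural {n} (t ∷ ts) ≤n = subst NaturalCoords (sym (mulφ^-+φ n (φ⁻ t) (Σφ⁻ ts)))
  (natural-+φ (nonzero⇒natural (mulφ^-φ⁻-nonzero (ℕP.≤-trans (ℕP.m≤m+n t (sum ts)) ≤n)))
              (mulφ^-Σφ⁻-natural ts (ℕP.≤-trans (ℕP.m≤n+m (sum ts) t) ≤n)))

mulφ^-Σφ⁻-nonzero : ∀ t ts → NonzeroNaturalCoords (mulφ^ (sum (t ∷ ts)) (Σφ⁻ (t ∷ ts)))
mulφ^-Σφ⁻-nonzero t ts = subst NonzeroNaturalCoords (sym (mulφ^-+φ (sum (t ∷ ts)) (φ⁻ t) (Σφ⁻ ts)))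
  (nonzero-+φ (mulφ^-φ⁻-nonzero (ℕP.m≤m+n t (sum ts))) (mulφ^-Σφ⁻-natural ts (ℕP.m≤n+m (sum ts) t)))

Σφ⁻-nonempty≢0φ : ∀ t ts → Σφ⁻ (t ∷ ts) ≢ 0φ
Σφ⁻-nonempty≢0φ t ts eq = ¬nonzero-0φ
  (subst NonzeroNaturalCoords (trans (cong (mulφ^ (sum (t ∷ ts))) eq) (mulφ^-0φ (sum (t ∷ ts))))
    (mulφ^-Σφ⁻-nonzero t ts))

-- Certified inequalities

infix 4 _≼_ _≺_ ∣_∣≼_

data _≼_ (x y : Zφ) : Set where
  gap : ∀ ts → x +φ Σφ⁻ ts ≡ y → x ≼ y

data _≺_ (x y : Zφ) : Set where
  gap⁺ : ∀ t → x +φ φ⁻ t ≼ y → x ≺ y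

≼-reflexive : ∀ {x y} → x ≡ y → x ≼ y
≼-reflexive {x} refl = gap [] (+φ-identityʳ x)

≼-trans : ∀ {x y z} → x ≼ y → y ≼ z → x ≼ z
≼-trans {x} {y} {z} (gap ts x+ts≡y) (gap us y+us≡z) = gap (ts ++ us) (begin
  x +φ Σφ⁻ (ts ++ us)           ≡⟨ cong (x +φ_) (Σφ⁻-++ ts us) ⟩
  x +φ (Σφ⁻ ts +φ Σφ⁻ us)       ≡⟨ sym (+φ-assoc x (Σφ⁻ ts) (Σφ⁻ us)) ⟩
  (x +φ Σφ⁻ ts) +φ Σφ⁻ us       ≡⟨ cong (_+φ Σφ⁻ us) x+ts≡y ⟩
  y +φ Σφ⁻ us                   ≡⟨ y+us≡z ⟩
  z                             ∎)
  where open ≡-Reasoning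

≼-isPreorder : IsPreorder _≡_ _≼_
≼-isPreorder = record { isEquivalence = isEquivalence ; reflexive = ≼-reflexive ; trans = ≼-trans }

+φ-monoˡ-≼ : ∀ {x y} z → x ≼ y → x +φ z ≼ y +φ z
+φ-monoˡ-≼ {x} z (gap ts eq) = gap ts (trans (xy∙z≈xz∙y x z (Σφ⁻ ts)) (cong (_+φ z) eq))

+φ-monoʳ-≼ : ∀ {x y} z → x ≼ y → z +φ x ≼ z +φ y
+φ-monoʳ-≼ {x} z (gap ts eq) = gap ts (trans (+φ-assoc z x (Σφ⁻ ts)) (cong (z +φ_) eq))

x≼x+y : ∀ x {y} → 0φ ≼ y → x ≼ x +φ y
x≼x+y x 0≼y = ≼-trans (≼-reflexive (sym (+φ-identityʳ x))) (+φ-monoʳ-≼ x 0≼y)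

x≼y+x : ∀ x {y} → 0φ ≼ y → x ≼ y +φ x
x≼y+x x {y} 0≼y = subst (x ≼_) (+φ-comm x y) (x≼x+y x 0≼y)

≺⇒≼ : ∀ {x y} → x ≺ y → x ≼ y
≺⇒≼ {x} (gap⁺ t x+φ⁻t≼y) = ≼-trans (gap (t ∷ []) (cong (x +φ_) (+φ-identityʳ (φ⁻ t)))) x+φ⁻t≼y

≺-≼-trans : ∀ {x y z} → x ≺ y → y ≼ z → x ≺ z
≺-≼-trans (gap⁺ t x+φ⁻t≼y) y≼z = gap⁺ t (≼-trans x+φ⁻t≼y y≼z)

≼-≺-trans : ∀ {x y z} → x ≼ y → y ≺ z → x ≺ z
≼-≺-trans x≼y (gap⁺ t y+φ⁻t≼z) = gap⁺ t (≼-trans (+φ-monoˡ-≼ (φ⁻ t) x≼y) y+φ⁻t≼z)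

≺-trans : ∀ {x y z} → x ≺ y → y ≺ z → x ≺ z
≺-trans x≺y y≺z = ≺-≼-trans x≺y (≺⇒≼ y≺z)

≺-irrefl : ∀ {x} → ¬ x ≺ x
≺-irrefl {x} (gap⁺ t (gap ts eq)) = Σφ⁻-nonempty≢0φ t ts (∙-cancelˡ x _ _ (begin
  x +φ (φ⁻ t +φ Σφ⁻ ts)   ≡⟨ sym (+φ-assoc x (φ⁻ t) (Σφ⁻ ts)) ⟩
  (x +φ φ⁻ t) +φ Σφ⁻ ts   ≡⟨ eq ⟩
  x                       ≡⟨ sym (+φ-identityʳ x) ⟩
  x +φ 0φ                 ∎))
  where open ≡-Reasoning

≺-asym : ∀ {x y} → x ≺ y → ¬ y ≺ x
≺-asym x≺y y≺x = ≺-irrefl (≺-trans x≺y y≺x)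

module ≼-Reasoning =
  TripleReasoning ≼-isPreorder ≺-asym ≺-trans (resp₂ _≺_) ≺⇒≼ ≺-≼-trans ≼-≺-trans

+φ-monoˡ-≺ : ∀ {x y} z → x ≺ y → x +φ z ≺ y +φ z
+φ-monoˡ-≺ {x} z (gap⁺ t x+φ⁻t≼y) =
  gap⁺ t (≼-trans (≼-reflexive (xy∙z≈xz∙y x z (φ⁻ t))) (+φ-monoˡ-≼ z x+φ⁻t≼y))

+φ-cancelˡ-≺ : ∀ z {x y} → z +φ x ≺ z +φ y → x ≺ y
+φ-cancelˡ-≺ z {x} {y} (gap⁺ t (gap ts eq)) = gap⁺ t (gap ts (∙-cancelˡ z _ _ (begin
  z +φ ((x +φ φ⁻ t) +φ Σφ⁻ ts)   ≡⟨ sym (+φ-assoc z (x +φ φ⁻ t) (Σφ⁻ ts)) ⟩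
  (z +φ (x +φ φ⁻ t)) +φ Σφ⁻ ts   ≡⟨ cong (_+φ Σφ⁻ ts) (sym (+φ-assoc z x (φ⁻ t))) ⟩
  ((z +φ x) +φ φ⁻ t) +φ Σφ⁻ ts   ≡⟨ eq ⟩
  z +φ y                         ∎)))
  where open ≡-Reasoning

ι-mono-≼ : ∀ {j k} → j ℤ.≤ k → ι j ≼ ι k
ι-mono-≼ {j} {k} j≤k = gap (replicate ℤ.∣ k ℤ.- j ∣ 0) (begin
  ι j +φ Σφ⁻ (replicate ℤ.∣ k ℤ.- j ∣ 0)   ≡⟨ cong (ι j +φ_) (Σφ⁻-replicate-0 ℤ.∣ k ℤ.- j ∣) ⟩
  ι (j ℤ.+ + ℤ.∣ k ℤ.- j ∣)               ≡⟨ cong (λ z → ι (j ℤ.+ z)) (ℤP.0≤i⇒+∣i∣≡i (ℤP.i≤j⇒0≤j-i j≤k)) ⟩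
  ι (j ℤ.+ (k ℤ.- j))                     ≡⟨ cong ι (solve (j ∷ k ∷ [])) ⟩
  ι k                                     ∎)
  where open ≡-Reasoning

ι-cancel-≺ : ∀ {j k} → ι j ≺ ι k → j ℤ.< k
ι-cancel-≺ {j} {k} ιj≺ιk with k ℤ.≤? j
... | yes k≤j = ⊥-elim (≺-irrefl (≺-≼-trans ιj≺ιk (ι-mono-≼ k≤j)))
... | no k≰j = ℤP.≰⇒> k≰j

0≼φ⁻ : ∀ t → 0φ ≼ φ⁻ t
0≼φ⁻ t = gap (t ∷ []) (trans (+φ-identityˡ _) (+φ-identityʳ (φ⁻ t)))

φ⁻-step : ∀ t → φ⁻ t ≡ φ⁻ (suc t) +φ φ⁻ (suc (suc t))
φ⁻-step t = mulφ⁻¹-split (φ⁻ t)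

φ⁻-suc≺φ⁻ : ∀ t → φ⁻ (suc t) ≺ φ⁻ t
φ⁻-suc≺φ⁻ t = gap⁺ (suc (suc t)) (gap [] (trans (+φ-identityʳ _) (sym (φ⁻-step t))))

φ⁻-antitone : ∀ {i j} → i ≤ j → φ⁻ j ≼ φ⁻ i
φ⁻-antitone {i} {j} i≤j = subst (λ s → φ⁻ s ≼ φ⁻ i) (ℕP.m∸n+n≡m i≤j) (φ⁻-+-antitone (j ∸ i))
  where
  φ⁻-+-antitone : ∀ d → φ⁻ (d + i) ≼ φ⁻ i
  φ⁻-+-antitone zero = ≼-reflexive refl
  φ⁻-+-antitone (suc d) = ≼-trans (≺⇒≼ (φ⁻-suc≺φ⁻ (d + i))) (φ⁻-+-antitone d)

record ∣_∣≼_ (x b : Zφ) : Set where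
  constructor bounds
  field
    upper : x ≼ b
    lower : 0φ ≼ x +φ b

open ∣_∣≼_

∣0φ∣≼ : ∀ {b} → 0φ ≼ b → ∣ 0φ ∣≼ b
∣0φ∣≼ {b} 0≼b = bounds 0≼b (subst (0φ ≼_) (sym (+φ-identityˡ b)) 0≼b)

∣b∣≼b : ∀ {b} → 0φ ≼ b → ∣ b ∣≼ b
∣b∣≼b {b} 0≼b = bounds (≼-reflexive refl) (≼-trans 0≼b (x≼x+y b 0≼b))

∣-b∣≼b : ∀ {b} → 0φ ≼ b → ∣ negφ b ∣≼ b
∣-b∣≼b {b} 0≼b = bounds
  (≼-trans (x≼x+y (negφ b) (≼-trans 0≼b (x≼x+y b 0≼b))) (≼-reflexive -b+[b+b]≡b))
  (≼-reflexive (sym (+φ-inverseˡ b)))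
  where
  -b+[b+b]≡b : negφ b +φ (b +φ b) ≡ b
  -b+[b+b]≡b = trans (sym (+φ-assoc (negφ b) b b)) (trans (cong (_+φ b) (+φ-inverseˡ b)) (+φ-identityˡ b))

∣∣≼-weaken : ∀ {x a b} → ∣ x ∣≼ a → a ≼ b → ∣ x ∣≼ b
∣∣≼-weaken {x} (bounds x≼a 0≼x+a) a≼b = bounds (≼-trans x≼a a≼b) (≼-trans 0≼x+a (+φ-monoʳ-≼ x a≼b))

∣∣≼-+φ : ∀ {x y a b} → ∣ x ∣≼ a → ∣ y ∣≼ b → ∣ x +φ y ∣≼ a +φ b
∣∣≼-+φ {x} {y} {a} {b} (bounds x≼a 0≼x+a) (bounds y≼b 0≼y+b) = bounds
  (≼-trans (+φ-monoˡ-≼ y x≼a) (+φ-monoʳ-≼ a y≼b))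
  (subst (0φ ≼_) (interchange x a y b) (≼-trans 0≼x+a (x≼x+y (x +φ a) 0≼y+b)))

∣conj-φ⁺∣≼φ⁻ : ∀ t → ∣ conj (φ⁺ t) ∣≼ φ⁻ t
∣conj-φ⁺∣≼φ⁻ t with conj-φ⁺ t
... | inj₁ eq = subst (∣_∣≼ φ⁻ t) (sym eq) (∣b∣≼b (0≼φ⁻ t))
... | inj₂ eq = subst (∣_∣≼ φ⁻ t) (sym eq) (∣-b∣≼b (0≼φ⁻ t))

-- posValue t bs is the value of the digits bs placed at positions t, t + 1, …; fracValue bs is the
-- value of the digits bs placed at positions −length bs, …, −1.
posValue : ℕ → List Bool → Zφ
posValue t [] = 0φ
posValue t (true ∷ bs) = φ⁺ t +φ posValue (suc t) bs
posValue t (false ∷ bs) = posValue (suc t) bs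

fracValue : List Bool → Zφ
fracValue [] = 0φ
fracValue (true ∷ bs) = φ⁻ (suc (length bs)) +φ fracValue bs
fracValue (false ∷ bs) = fracValue bs

valAux-posValue : ∀ t bs → valAux (+ t) bs ≡ posValue t bs
valAux-posValue t [] = refl
valAux-posValue t (b ∷ bs) = trans (cong ((if b then φ^ (+ t) else 0φ) +φ_) tail) (leading-digit b)
  where
  tail : valAux (+ t ℤ.+ + 1) bs ≡ posValue (suc t) bs
  tail = trans (cong (λ s → valAux (+ s) bs) (ℕP.+-comm t 1)) (valAux-posValue (suc t) bs)
  leading-digit : ∀ b → (if b then φ^ (+ t) else 0φ) +φ posValue (suc t) bs ≡ posValue t (b ∷ bs)
  leading-digit true = cong (_+φ posValue (suc t) bs) (powℕ-φ t)
  leading-digit false = +φ-identityˡ _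

valAux-split : ∀ pre ys → valAux (ℤ.- (+ length pre)) (pre ++ ys) ≡ fracValue pre +φ posValue 0 ys
valAux-split [] ys = trans (valAux-posValue 0 ys) (sym (+φ-identityˡ _))
valAux-split (b ∷ pre) ys = trans (cong ((if b then φ^ -[1+ n ] else 0φ) +φ_) tail) (leading-digit b)
  where
  n : ℕ
  n = length pre
  tail : valAux (-[1+ n ] ℤ.+ + 1) (pre ++ ys) ≡ fracValue pre +φ posValue 0 ys
  tail = trans (cong (λ k → valAux k (pre ++ ys)) (trans (ℤP.+-comm -[1+ n ] (+ 1)) (ℤP.1-[1+n]≡-n n)))
               (valAux-split pre ys)
  leading-digit : ∀ b → (if b then φ^ -[1+ n ] else 0φ) +φ (fracValue pre +φ posValue 0 ys)
                      ≡ fracValue (b ∷ pre) +φ posValue 0 ys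
  leading-digit true = trans (cong (_+φ (fracValue pre +φ posValue 0 ys)) (powℕ-φ⁻¹ (suc n)))
                              (sym (+φ-assoc (φ⁻ (suc n)) (fracValue pre) (posValue 0 ys)))
  leading-digit false = +φ-identityˡ _

posValue-zeros : ∀ t n ys → posValue t (replicate n false ++ ys) ≡ posValue (t + n) ys
posValue-zeros t zero ys = cong (λ s → posValue s ys) (sym (ℕP.+-identityʳ t))
posValue-zeros t (suc n) ys = trans (posValue-zeros (suc t) n ys) (cong (λ s → posValue s ys) (sym (ℕP.+-suc t n)))

NoAdj-∷⁻ : ∀ {b} xs → NoAdj (b ∷ xs) → NoAdj xs
NoAdj-∷⁻ [] _ = tt
NoAdj-∷⁻ {false} (x ∷ xs) na = na
NoAdj-∷⁻ {true} (false ∷ xs) na = na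
NoAdj-∷⁻ {true} (true ∷ xs) ()

NoAdj-++⁻ʳ : ∀ xs {ys} → NoAdj (xs ++ ys) → NoAdj ys
NoAdj-++⁻ʳ [] na = na
NoAdj-++⁻ʳ (x ∷ xs) na = NoAdj-++⁻ʳ xs (NoAdj-∷⁻ (xs ++ _) na)

0≼fracValue : ∀ bs → 0φ ≼ fracValue bs
0≼fracValue [] = ≼-reflexive refl
0≼fracValue (true ∷ bs) = ≼-trans (0≼fracValue bs) (x≼y+x (fracValue bs) (0≼φ⁻ (suc (length bs))))
0≼fracValue (false ∷ bs) = 0≼fracValue bs

fracValue+φ⁻≼φ⁻₁ : ∀ bs {ys} → NoAdj (bs ++ true ∷ ys) → fracValue bs +φ φ⁻ (suc (length bs)) ≼ φ⁻ 1
fracValue+φ⁻≼φ⁻₁ [] _ = ≼-reflexive (+φ-identityˡ _)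
fracValue+φ⁻≼φ⁻₁ (false ∷ bs) na =
  ≼-trans (+φ-monoʳ-≼ (fracValue bs) (≺⇒≼ (φ⁻-suc≺φ⁻ (suc (length bs)))))
          (fracValue+φ⁻≼φ⁻₁ bs (NoAdj-∷⁻ (bs ++ _) na))
fracValue+φ⁻≼φ⁻₁ (true ∷ []) ()
fracValue+φ⁻≼φ⁻₁ (true ∷ true ∷ bs) ()
fracValue+φ⁻≼φ⁻₁ (true ∷ false ∷ bs) na = ≼-trans (≼-reflexive regroup) (fracValue+φ⁻≼φ⁻₁ bs (NoAdj-∷⁻ (bs ++ _) na))
  where
  n = length bs
  regroup : (φ⁻ (suc (suc n)) +φ fracValue bs) +φ φ⁻ (suc (suc (suc n))) ≡ fracValue bs +φ φ⁻ (suc n)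
  regroup = trans (xy∙z≈y∙xz (φ⁻ (suc (suc n))) (fracValue bs) (φ⁻ (suc (suc (suc n))))) (cong (fracValue bs +φ_) (sym (φ⁻-step (suc n))))

fracValue≺φ⁻₁ : ∀ bs {ys} → NoAdj (bs ++ true ∷ ys) → fracValue bs ≺ φ⁻ 1
fracValue≺φ⁻₁ bs na = gap⁺ (suc (length bs)) (fracValue+φ⁻≼φ⁻₁ bs na)

∣conj-posValue∣≼ : ∀ u bs → NoAdj bs → ∣ conj (posValue (suc u) bs) ∣≼ φ⁻ u
∣conj-posValue∣≼-after1 : ∀ u bs → NoAdj (true ∷ bs) → ∣ conj (posValue (suc u) bs) ∣≼ φ⁻ (suc u)

∣conj-posValue∣≼ u [] _ = ∣0φ∣≼ (0≼φ⁻ u)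
∣conj-posValue∣≼ u (false ∷ bs) na =
  ∣∣≼-weaken (∣conj-posValue∣≼ (suc u) bs (NoAdj-∷⁻ bs na)) (≺⇒≼ (φ⁻-suc≺φ⁻ u))
∣conj-posValue∣≼ u (true ∷ bs) na =
  subst₂ ∣_∣≼_ (sym (conj-+φ (φ⁺ (suc u)) _)) (sym (φ⁻-step u))
    (∣∣≼-+φ (∣conj-φ⁺∣≼φ⁻ (suc u)) (∣conj-posValue∣≼-after1 (suc u) bs na))

∣conj-posValue∣≼-after1 u [] _ = ∣0φ∣≼ (0≼φ⁻ (suc u))
∣conj-posValue∣≼-after1 u (false ∷ bs) na = ∣conj-posValue∣≼ (suc u) bs (NoAdj-∷⁻ bs na)
∣conj-posValue∣≼-after1 u (true ∷ bs) ()

integral-sum⇒conj : ∀ x y {n} → x +φ y ≡ ι n → ∃[ k ] x ≡ ι k +φ conj y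
integral-sum⇒conj (a , b) (c , d) eq = a ℤ.- (c ℤ.+ d) , cong₂ _,_ a≡ b≡-d
  where
  open ≡-Reasoning
  a≡ : a ≡ (a ℤ.- (c ℤ.+ d)) ℤ.+ (c ℤ.+ d)
  a≡ = solve (a ∷ c ∷ d ∷ [])
  b≡-d : b ≡ + 0 ℤ.+ ℤ.- d
  b≡-d = begin
    b                  ≡⟨ solve (b ∷ d ∷ []) ⟩
    (b ℤ.+ d) ℤ.- d    ≡⟨ cong (ℤ._- d) (cong proj₂ eq) ⟩
    + 0 ℤ.- d          ∎

conj-trace : ∀ m F A {n} → F +φ (ι (+ 1) +φ (φ⁺ (suc (2 * m)) +φ A)) ≡ ι n →
             ∃[ k ] F +φ φ⁻ (suc (2 * m)) ≡ ι k +φ conj A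
conj-trace m F A F+…≡n with integral-sum⇒conj F _ F+…≡n
... | k , F≡ = k ℤ.+ + 1 , (begin
  F +φ Q                                             ≡⟨ cong (_+φ Q) F≡ ⟩
  (ι k +φ conj (ι (+ 1) +φ (φ⁺ (suc (2 * m)) +φ A))) +φ Q ≡⟨ cong (λ z → (ι k +φ z) +φ Q) conj-expand ⟩
  (ι k +φ (ι (+ 1) +φ (negφ Q +φ conj A))) +φ Q      ≡⟨ cong (_+φ Q) (sym (+φ-assoc (ι k) (ι (+ 1)) (negφ Q +φ conj A))) ⟩
  ((ι k +φ ι (+ 1)) +φ (negφ Q +φ conj A)) +φ Q      ≡⟨ +φ-assoc (ι (k ℤ.+ + 1)) (negφ Q +φ conj A) Q ⟩
  ι (k ℤ.+ + 1) +φ ((negφ Q +φ conj A) +φ Q)         ≡⟨ cong (ι (k ℤ.+ + 1) +φ_) -Q+C+Q≡C ⟩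
  ι (k ℤ.+ + 1) +φ conj A                            ∎)
  where
  open ≡-Reasoning
  Q : Zφ
  Q = φ⁻ (suc (2 * m))
  conj-expand : conj (ι (+ 1) +φ (φ⁺ (suc (2 * m)) +φ A)) ≡ ι (+ 1) +φ (negφ Q +φ conj A)
  conj-expand = trans (conj-+φ (ι (+ 1)) (φ⁺ (suc (2 * m)) +φ A))
    (cong (ι (+ 1) +φ_) (trans (conj-+φ (φ⁺ (suc (2 * m))) A) (cong (_+φ conj A) (conj-φ⁺-odd m))))
  -Q+C+Q≡C : (negφ Q +φ conj A) +φ Q ≡ conj A
  -Q+C+Q≡C = trans (xy∙z≈y∙xz (negφ Q) (conj A) Q) (trans (cong (conj A +φ_) (+φ-inverseˡ Q)) (+φ-identityʳ (conj A)))

no-10²ᵐ1-at-0 : ∀ m → 1 ≤ m → ∀ pre rest {n} →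
  let bits = pre ++ true ∷ replicate (2 * m) false ++ true ∷ rest in
  NoAdj bits → valAux (ℤ.- (+ length pre)) bits ≡ ι n → ⊥
no-10²ᵐ1-at-0 m 1≤m pre rest {n} na hv = ℤP.<-irrefl refl (ℤP.≤-<-trans (ℤP.i<j⇒suc[i]≤j 0<k) k<1)
  where
  open ≼-Reasoning
  ℓ : ℕ
  ℓ = suc (2 * m)
  F A : Zφ
  F = fracValue pre
  A = posValue (suc ℓ) rest
  value≡n : F +φ (ι (+ 1) +φ (φ⁺ ℓ +φ A)) ≡ ι n
  value≡n = trans (cong (λ z → F +φ (ι (+ 1) +φ z)) (sym (posValue-zeros 1 (2 * m) (true ∷ rest))))
                (trans (sym (valAux-split pre _)) hv)
  k : ℤ
  k = proj₁ (conj-trace m F A value≡n)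
  trace : F +φ φ⁻ ℓ ≡ ι k +φ conj A
  trace = proj₂ (conj-trace m F A value≡n)
  ∣conjA∣≼ : ∣ conj A ∣≼ φ⁻ (suc ℓ)
  ∣conjA∣≼ = ∣conj-posValue∣≼-after1 ℓ rest (NoAdj-++⁻ʳ (true ∷ replicate (2 * m) false) (NoAdj-++⁻ʳ pre na))
  0<k : + 0 ℤ.< k
  0<k = ι-cancel-≺ (+φ-cancelˡ-≺ (φ⁻ (suc ℓ)) (begin-strict
    φ⁻ (suc ℓ) +φ ι (+ 0)   ≡⟨ +φ-identityʳ (φ⁻ (suc ℓ)) ⟩
    φ⁻ (suc ℓ)              <⟨ φ⁻-suc≺φ⁻ ℓ ⟩
    φ⁻ ℓ                    ≤⟨ x≼y+x (φ⁻ ℓ) (0≼fracValue pre) ⟩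
    F +φ φ⁻ ℓ               ≡⟨ trace ⟩
    ι k +φ conj A           ≤⟨ +φ-monoʳ-≼ (ι k) (upper ∣conjA∣≼) ⟩
    ι k +φ φ⁻ (suc ℓ)       ≡⟨ +φ-comm (ι k) (φ⁻ (suc ℓ)) ⟩
    φ⁻ (suc ℓ) +φ ι k       ∎))
  k<1 : k ℤ.< + 1
  k<1 = ι-cancel-≺ (begin-strict
    ι k                                ≤⟨ x≼x+y (ι k) (lower ∣conjA∣≼) ⟩
    ι k +φ (conj A +φ φ⁻ (suc ℓ))      ≡⟨ sym (+φ-assoc (ι k) (conj A) (φ⁻ (suc ℓ))) ⟩
    (ι k +φ conj A) +φ φ⁻ (suc ℓ)      ≡⟨ cong (_+φ φ⁻ (suc ℓ)) (sym trace) ⟩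
    (F +φ φ⁻ ℓ) +φ φ⁻ (suc ℓ)          ≡⟨ +φ-assoc F (φ⁻ ℓ) (φ⁻ (suc ℓ)) ⟩
    F +φ (φ⁻ ℓ +φ φ⁻ (suc ℓ))          ≡⟨ cong (F +φ_) (sym (φ⁻-step (2 * m))) ⟩
    F +φ φ⁻ (2 * m)                    <⟨ +φ-monoˡ-≺ (φ⁻ (2 * m)) (fracValue≺φ⁻₁ pre na) ⟩
    φ⁻ 1 +φ φ⁻ (2 * m)                 ≤⟨ +φ-monoʳ-≼ (φ⁻ 1) (φ⁻-antitone (ℕP.*-monoʳ-≤ 2 1≤m)) ⟩
    φ⁻ 1 +φ φ⁻ 2                       ≡⟨ sym (φ⁻-step 0) ⟩
    ι (+ 1)                            ∎)

-- Reading the suffix off an expansion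

dig-lookupB : ∀ n₀ bits i → dig (mkExp (ℤ.- (+ n₀)) bits) (+ i) ≡ lookupB bits (i + n₀)
dig-lookupB zero bits i = refl
dig-lookupB (suc n₀) bits i = refl

lookupB-++ : ∀ xs ys j → lookupB (xs ++ ys) (length xs + j) ≡ lookupB ys j
lookupB-++ [] ys j = refl
lookupB-++ (x ∷ xs) ys j = lookupB-++ xs ys j

lookupB-split : ∀ bs n → lookupB bs n ≡ true → ∃[ pre ] ∃[ post ] bs ≡ pre ++ true ∷ post × length pre ≡ n
lookupB-split (true ∷ bs) zero _ = [] , bs , refl , refl
lookupB-split (b ∷ bs) (suc n) bₙ with lookupB-split bs n bₙ
... | pre , post , refl , refl = b ∷ pre , post , refl , refl

zeros-then-one : ∀ n xs → (∀ j → j < n → lookupB xs j ≡ false) → lookupB xs n ≡ true →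
                 ∃[ rest ] xs ≡ replicate n false ++ true ∷ rest
zeros-then-one zero (true ∷ xs) _ _ = xs , refl
zeros-then-one (suc n) (x ∷ xs) zeros one with zeros 0 (s≤s z≤n)
... | refl with zeros-then-one n xs (λ j j<n → zeros (suc j) (s≤s j<n)) one
...   | rest , refl = rest , refl

HasSuffix10²ᵐ1 : ℕ → Expansion → Set
HasSuffix10²ᵐ1 m E =
  (dig E (+ (2 * m + 1)) ≡ true) × ((i : ℕ) → 1 ≤ i → i ≤ 2 * m → dig E (+ i) ≡ false) × (dig E (+ 0) ≡ true)

suffix-split : ∀ m n₀ bits → HasSuffix10²ᵐ1 m (mkExp (ℤ.- (+ n₀)) bits) →
  ∃[ pre ] ∃[ rest ] bits ≡ pre ++ true ∷ replicate (2 * m) false ++ true ∷ rest × length pre ≡ n₀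
suffix-split m n₀ bits (d₂ₘ₊₁ , d₁…₂ₘ , d₀) with lookupB-split bits n₀ (trans (sym (dig-lookupB n₀ bits 0)) d₀)
... | pre , post , refl , refl with zeros-then-one (2 * m) post zeros one
  where
  E : Expansion
  E = mkExp (ℤ.- (+ length pre)) (pre ++ true ∷ post)
  digit : ∀ i → dig E (+ i) ≡ lookupB (true ∷ post) i
  digit i = trans (dig-lookupB (length pre) (pre ++ true ∷ post) i)
                  (trans (cong (lookupB (pre ++ true ∷ post)) (ℕP.+-comm i (length pre))) (lookupB-++ pre _ i))
  zeros : ∀ j → j < 2 * m → lookupB post j ≡ false
  zeros j j<2m = trans (sym (digit (suc j))) (d₁…₂ₘ (suc j) (s≤s z≤n) j<2m)
  one : lookupB post (2 * m) ≡ true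
  one = trans (sym (digit (suc (2 * m)))) (subst (λ i → dig E (+ i) ≡ true) (ℕP.+-comm (2 * m) 1) d₂ₘ₊₁)
... | rest , refl = pre , rest , refl , refl

no-suffix-10²ᵐ1 : ∀ m → 1 ≤ m → ∀ n₀ bits {N} → IsBasePhiExpansion N (mkExp (ℤ.- (+ n₀)) bits) →
                  ¬ HasSuffix10²ᵐ1 m (mkExp (ℤ.- (+ n₀)) bits)
no-suffix-10²ᵐ1 m 1≤m n₀ bits (na , hv) suffix with suffix-split m n₀ bits suffix
... | pre , rest , refl , refl = no-10²ᵐ1-at-0 m 1≤m pre rest na hv

lemma6p4 : (m : ℕ) → 2 ≤ m → (N : ℕ) → 1 ≤ N → (E : Expansion) → IsBasePhiExpansion N E →
    ¬ ((dig E (+ (2 * m + 1)) ≡ true) × ((i : ℕ) → 1 ≤ i → i ≤ 2 * m → dig E (+ i) ≡ false) × (dig E (+ 0) ≡ true))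
lemma6p4 m 2≤m N _ (mkExp (+ suc n) bits) _ (_ , _ , ())
lemma6p4 m 2≤m N _ (mkExp (+ zero) bits) valid suffix = no-suffix-10²ᵐ1 m (ℕP.<⇒≤ 2≤m) 0 bits valid suffix
lemma6p4 m 2≤m N _ (mkExp -[1+ n ] bits) valid suffix = no-suffix-10²ᵐ1 m (ℕP.<⇒≤ 2≤m) (suc n) bits valid suffix
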